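{- Let $A\in[0,1]^{n\times n}$ and $0<\lambda<1$. The set of Łukasiewicz eigenvectors of $A$ associated with $\lambda$ (vectors $x\in[0,1]^n$ with $A\otimes_L x=\lambda\otimes_L x$) has a greatest element $z$, and the partition $(K,L)$ with $K=\{i: z_i\ge1-\lambda\}$, $L=\{i:z_i<1-\lambda\}$ is the least secure partition of $\mathcal{G}(A^{(\lambda)})$: it is secure, and $L\subseteq L'$ for every secure partition $(K',L')$.
   Context: $a\otimes_L b=\max(0,a+b-1)$, $(A\otimes_L x)_i=\max_j\max(0,a_{ij}+x_j-1)$, $(\lambda\otimes_L x)_i=\max(0,\lambda+x_i-1)$. $A^{(\lambda)}$ has entries $a_{ij}-\lambda$; $\mathcal{G}(A^{(\lambda)})$ is the weighted digraph on $\{1,\dots,n\}$ with edge $(i,j)$ of weight $a_{ij}-\lambda$, walk weights being sums of edge weights. A partition $(K,L)$ of $\{1,\dots,n\}$ is secure if: when $K,L$ are both nonempty, every walk starting in a node of $L$ with all other nodes in $K$ has nonpositive weight; $(\{1,\dots,n\},\emptyset)$ is secure iff every walk has weight $\le\lambda$; $(\emptyset,\{1,\dots,n\})$ is always secure. -}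

module Defs where

open import Level using (Level) renaming (suc to lsuc; zero to lzero)
open import Data.Nat using (ℕ; zero; suc)
open import Data.Fin using (Fin)
open import Data.Fin.Subset using (Subset; _∈_; _∉_; Nonempty; ∁)
open import Data.List using (List; []; _∷_)
open import Data.List.Relation.Unary.All using (All)
open import Data.Product using (Σ; ∃; _×_; _,_)
open import Data.Sum using (_⊎_; inj₁; inj₂)
open import Relation.Binary.PropositionalEquality using (_≡_; _≢_)

-- The real numbers, axiomatized as a complete ordered field
-- (unique up to isomorphism, so quantifying over all models = speaking about ℝ).
record CompleteOrderedField : Set₁ where
  infixl 6 _+_
  infixl 7 _*_
  infix 4 _≤_
  field
    R : Set
    0# 1# : R
    _+_ _*_ : R → R → R
    -_ : R → R
    inv : (x : R) → x ≢ 0# → R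
    _≤_ : R → R → Set
    +-assoc : ∀ x y z → (x + y) + z ≡ x + (y + z)
    +-comm : ∀ x y → x + y ≡ y + x
    +-identityˡ : ∀ x → 0# + x ≡ x
    -‿inverseˡ : ∀ x → (- x) + x ≡ 0#
    *-assoc : ∀ x y z → (x * y) * z ≡ x * (y * z)
    *-comm : ∀ x y → x * y ≡ y * x
    *-identityˡ : ∀ x → 1# * x ≡ x
    distribˡ : ∀ x y z → x * (y + z) ≡ (x * y) + (x * z)
    inv-inverse : ∀ x (p : x ≢ 0#) → x * inv x p ≡ 1#
    0≢1 : 0# ≢ 1#
    ≤-refl : ∀ x → x ≤ x
    ≤-trans : ∀ {x y z} → x ≤ y → y ≤ z → x ≤ z
    ≤-antisym : ∀ {x y} → x ≤ y → y ≤ x → x ≡ y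
    ≤-total : ∀ x y → x ≤ y ⊎ y ≤ x
    +-mono-≤ : ∀ {x y} z → x ≤ y → x + z ≤ y + z
    *-nonneg : ∀ {x y} → 0# ≤ x → 0# ≤ y → 0# ≤ x * y
    sup : (P : R → Set) → (∃ λ x → P x) → (∃ λ b → ∀ x → P x → x ≤ b) →
          ∃ λ s → (∀ x → P x → x ≤ s) × (∀ b → (∀ x → P x → x ≤ b) → s ≤ b)

module Luk (F : CompleteOrderedField) where
  open CompleteOrderedField F

  infixl 6 _-_
  _-_ : R → R → R
  x - y = x + (- y)

  _<_ : R → R → Set
  x < y = (x ≤ y) × (x ≢ y)

  max : R → R → R
  max x y with ≤-total x y
  ... | inj₁ _ = y
  ... | inj₂ _ = x

  _⊗L_ : R → R → R
  a ⊗L b = max 0# (a + b - 1#)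

  -- maximum of finitely many values, seeded with 0 (all Łukasiewicz terms are ≥ 0)
  max0 : ∀ n → (Fin n → R) → R
  max0 zero f = 0#
  max0 (suc n) f = max (f Fin.zero) (max0 n (λ j → f (Fin.suc j)))

  Matrix : ℕ → Set
  Matrix n = Fin n → Fin n → R

  Vector : ℕ → Set
  Vector n = Fin n → R

  mulL : ∀ {n} → Matrix n → Vector n → Vector n
  mulL {n} A x i = max0 n (λ j → A i j ⊗L x j)

  scaleL : ∀ {n} → R → Vector n → Vector n
  scaleL l x i = l ⊗L x i

  InUnit : R → Set
  InUnit a = (0# ≤ a) × (a ≤ 1#)

  IsEigenvector : ∀ {n} → Matrix n → R → Vector n → Set
  IsEigenvector A l x = (∀ i → InUnit (x i)) × (∀ i → mulL A x i ≡ scaleL l x i)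

  IsGreatestEigenvector : ∀ {n} → Matrix n → R → Vector n → Set
  IsGreatestEigenvector A l z =
    IsEigenvector A l z × (∀ x → IsEigenvector A l x → ∀ i → x i ≤ z i)

  -- weight in G(A^(λ)) of the walk i → j₁ → … → j_k (edge (i,j) weight a_ij - λ)
  walkWeight : ∀ {n} → Matrix n → R → Fin n → List (Fin n) → R
  walkWeight A l i [] = 0#
  walkWeight A l i (j ∷ js) = (A i j - l) + walkWeight A l j js

  Secure : ∀ {n} → Matrix n → R → Subset n → Set
  Secure {n} A l K =
    (Nonempty K → Nonempty (∁ K) →
       ∀ i js → i ∉ K → All (λ j → j ∈ K) js → walkWeight A l i js ≤ 0#)
    × ((∀ i → i ∈ K) → ∀ i js → walkWeight A l i js ≤ l)

module Submission where

-- Write μ = 1 - λ.  Everything rests on the additive description of the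
-- Łukasiewicz product, a ⊗ b ≤ c ⟺ (0 ≤ c and a + b ≤ c + 1), which makes
-- b ↦ a ⊗ b commute with suprema.  Since x is an eigenvector iff
-- a_ik ⊗ x_k ≤ λ ⊗ x_i for all i, k and λ ⊗ x_i ≤ (A ⊗ x)_i for all i, the
-- pointwise supremum z of all eigenvectors (they lie in [0,1]^n and include 0)
-- is again an eigenvector, hence the greatest one.
--   Security of K = {i : μ ≤ z_i}: the eigenvector inequality for z reads
-- a_jk + z_k ≤ λ + z_j when j ∈ K and a_jk + z_k ≤ 1 when j ∉ K, so along a
-- walk inside K the quantity μ + (walk weight) stays below z at the start;
-- this bounds walks leaving L by 0 and, when K is everything, walks by λ.
--   Minimality: for a secure K′, the vector x_j = sup of μ + w over the walks
-- w inside K′ starting at j (and 0) is an eigenvector with x_j ≥ μ on K′, so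
-- K′ ⊆ K because x ≤ z.

open import Defs
open import Data.Nat using (ℕ)
open import Data.Fin using (Fin)
open import Data.Fin.Subset using (Subset; _∈_; _∉_)
open import Data.Product using (Σ; _×_)
open import Function.Bundles using (_⇔_)

open import Data.Nat using (zero; suc)
open import Data.Fin.Subset using (∁)
open import Data.Fin.Subset.Properties using (_∈?_; nonempty?; x∉p⇒x∈∁p; x∉∁p⇒x∈p; x∈∁p⇒x∉p)
open import Data.Product using (_,_; proj₁; proj₂; ∃)
open import Data.Sum using (_⊎_; inj₁; inj₂)
open import Data.Unit using (⊤; tt)
open import Data.Empty using (⊥-elim)
open import Data.List using (List; []; _∷_)
open import Data.List.Relation.Unary.All using (All; []; _∷_)
open import Relation.Nullary using (yes; no)
open import Relation.Binary.Bundles using (Poset)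
import Relation.Binary.Reasoning.PartialOrder as PartialOrderReasoning
open import Relation.Binary.PropositionalEquality using (_≡_; refl; sym; trans; cong; subst; subst₂; isEquivalence; module ≡-Reasoning)
open import Function.Bundles using (Equivalence)

module LukasiewiczEigen (F : CompleteOrderedField) where
  open CompleteOrderedField F
  open Luk F

  +-identityʳ : ∀ x → x + 0# ≡ x
  +-identityʳ x = trans (+-comm x 0#) (+-identityˡ x)

  -‿inverseʳ : ∀ x → x + (- x) ≡ 0#
  -‿inverseʳ x = trans (+-comm x (- x)) (-‿inverseˡ x)

  +-swap : ∀ x y w → x + (y + w) ≡ y + (x + w)
  +-swap x y w = trans (sym (+-assoc x y w)) (trans (cong (_+ w) (+-comm x y)) (+-assoc y x w))

  +-minus : ∀ x y → (x + y) - y ≡ x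
  +-minus x y = trans (+-assoc x y (- y)) (trans (cong (x +_) (-‿inverseʳ y)) (+-identityʳ x))

  minus-+ : ∀ x y → (x - y) + y ≡ x
  minus-+ x y = trans (+-assoc x (- y) y) (trans (cong (x +_) (-‿inverseˡ y)) (+-identityʳ x))

  plus-minus : ∀ a d → a + (d - a) ≡ d
  plus-minus a d = trans (+-comm a (d - a)) (minus-+ d a)

  -- Exchanging the two "edge weights" a and u in a + ((u - l) + w); this is the
  -- bookkeeping behind extending a walk by one edge.
  exchange : ∀ a u l w → a + ((u - l) + w) ≡ u + ((a - l) + w)
  exchange a u l w = begin
    a + ((u - l) + w)   ≡⟨ cong (a +_) (+-assoc u (- l) w) ⟩
    a + (u + (- l + w)) ≡⟨ +-swap a u (- l + w) ⟩
    u + (a + (- l + w)) ≡⟨ cong (u +_) (sym (+-assoc a (- l) w)) ⟩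
    u + ((a - l) + w)   ∎
    where open ≡-Reasoning

  ≤-poset : Poset _ _ _
  ≤-poset = record
    { Carrier = R ; _≈_ = _≡_ ; _≤_ = _≤_
    ; isPartialOrder = record
      { isPreorder = record
        { isEquivalence = isEquivalence
        ; reflexive = λ { refl → ≤-refl _ }
        ; trans = ≤-trans }
      ; antisym = ≤-antisym } }

  module ≤-Reasoning = PartialOrderReasoning ≤-poset

  ≤-reflexive : ∀ {x y} → x ≡ y → x ≤ y
  ≤-reflexive refl = ≤-refl _

  +-monoʳ-≤ : ∀ {x y} z → x ≤ y → z + x ≤ z + y
  +-monoʳ-≤ {x} {y} z x≤y =
    subst₂ _≤_ (+-comm x z) (+-comm y z) (+-mono-≤ z x≤y)

  +-cancelʳ-≤ : ∀ {x y} z → x + z ≤ y + z → x ≤ y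
  +-cancelʳ-≤ {x} {y} z p = subst₂ _≤_ (+-minus x z) (+-minus y z) (+-mono-≤ (- z) p)

  +-cancelˡ-≤ : ∀ {x y} z → z + x ≤ z + y → x ≤ y
  +-cancelˡ-≤ {x} {y} z p = +-cancelʳ-≤ z (subst₂ _≤_ (+-comm z x) (+-comm z y) p)

  +-mono-≤₂ : ∀ {a b c d} → a ≤ b → c ≤ d → a + c ≤ b + d
  +-mono-≤₂ {b = b} {c} p q = ≤-trans (+-mono-≤ c p) (+-monoʳ-≤ b q)

  ≤-+ˡ : ∀ {a} x → 0# ≤ a → x ≤ a + x
  ≤-+ˡ {a} x 0≤a = subst (_≤ a + x) (+-identityˡ x) (+-mono-≤ x 0≤a)

  move-right : ∀ {a x d} → a + x ≤ d → x ≤ d - a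
  move-right {a} {x} {d} p = +-cancelˡ-≤ a (subst (a + x ≤_) (sym (plus-minus a d)) p)

  move-left : ∀ {a x d} → x ≤ d - a → a + x ≤ d
  move-left {a} {x} {d} p = subst (a + x ≤_) (plus-minus a d) (+-monoʳ-≤ a p)

  module _ {I : Set} (f : I → R) (i₀ : I) {b : R} (bounded : ∀ i → f i ≤ b) where
    private
      Image : R → Set
      Image t = ∃ λ i → f i ≡ t

      lub : ∃ λ s → (∀ t → Image t → t ≤ s) × (∀ c → (∀ t → Image t → t ≤ c) → s ≤ c)
      lub = sup Image (f i₀ , i₀ , refl) (b , λ { t (i , refl) → bounded i })

    ⨆ : R
    ⨆ = proj₁ lub

    ⨆-ub : ∀ i → f i ≤ ⨆
    ⨆-ub i = proj₁ (proj₂ lub) (f i) (i , refl)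

    ⨆-least : ∀ {c} → (∀ i → f i ≤ c) → ⨆ ≤ c
    ⨆-least {c} h = proj₂ (proj₂ lub) c λ { t (i , refl) → h i }

  max-ubˡ : ∀ x y → x ≤ max x y
  max-ubˡ x y with ≤-total x y
  ... | inj₁ x≤y = x≤y
  ... | inj₂ _ = ≤-refl x

  max-ubʳ : ∀ x y → y ≤ max x y
  max-ubʳ x y with ≤-total x y
  ... | inj₁ _ = ≤-refl y
  ... | inj₂ y≤x = y≤x

  max-lub : ∀ {x y c} → x ≤ c → y ≤ c → max x y ≤ c
  max-lub {x} {y} x≤c y≤c with ≤-total x y
  ... | inj₁ _ = y≤c
  ... | inj₂ _ = x≤c

  max0-nonneg : ∀ n f → 0# ≤ max0 n f
  max0-nonneg zero f = ≤-refl 0#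
  max0-nonneg (suc n) f = ≤-trans (max0-nonneg n _) (max-ubʳ _ _)

  max0-ub : ∀ n f k → f k ≤ max0 n f
  max0-ub (suc n) f Fin.zero = max-ubˡ _ _
  max0-ub (suc n) f (Fin.suc k) = ≤-trans (max0-ub n (λ j → f (Fin.suc j)) k) (max-ubʳ _ _)

  max0-least : ∀ n f {c} → 0# ≤ c → (∀ k → f k ≤ c) → max0 n f ≤ c
  max0-least zero f 0≤c h = 0≤c
  max0-least (suc n) f 0≤c h = max-lub (h Fin.zero) (max0-least n _ 0≤c (λ k → h (Fin.suc k)))

  max0-mono : ∀ n {f g} → (∀ k → f k ≤ g k) → max0 n f ≤ max0 n g
  max0-mono n {f} {g} h =
    max0-least n f (max0-nonneg n g) (λ k → ≤-trans (h k) (max0-ub n g k))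

  ⊗-nonneg : ∀ a b → 0# ≤ a ⊗L b
  ⊗-nonneg a b = max-ubˡ 0# _

  ⊗-ge : ∀ a b → a + b ≤ (a ⊗L b) + 1#
  ⊗-ge a b = subst (_≤ (a ⊗L b) + 1#) (minus-+ (a + b) 1#) (+-mono-≤ 1# (max-ubʳ 0# _))

  ⊗-le : ∀ {a b c} → 0# ≤ c → a + b ≤ c + 1# → a ⊗L b ≤ c
  ⊗-le {a} {b} {c} 0≤c p = max-lub 0≤c (subst (a + b - 1# ≤_) (+-minus c 1#) (+-mono-≤ (- 1#) p))

  ⊗-vanish : ∀ {a b c} → a + b ≤ 1# → 0# ≤ c → a ⊗L b ≤ c
  ⊗-vanish {c = c} p 0≤c =
    ⊗-le 0≤c (≤-trans p (subst (_≤ c + 1#) (+-identityˡ 1#) (+-mono-≤ 1# 0≤c)))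

  ⊗-exact : ∀ {a b} → 1# ≤ a + b → (a ⊗L b) + 1# ≤ a + b
  ⊗-exact {a} {b} p = subst ((a ⊗L b) + 1# ≤_) (minus-+ (a + b) 1#)
    (+-mono-≤ 1# (⊗-le (subst (_≤ a + b - 1#) (-‿inverseʳ 1#) (+-mono-≤ (- 1#) p))
                        (≤-reflexive (sym (minus-+ (a + b) 1#)))))

  ⊗-mono : ∀ a {b b′} → b ≤ b′ → a ⊗L b ≤ a ⊗L b′
  ⊗-mono a {b} {b′} p = ⊗-le (⊗-nonneg a b′) (≤-trans (+-monoʳ-≤ a p) (⊗-ge a b′))

  ⊗-cong : ∀ {a b c d} → a + b ≡ c + d → a ⊗L b ≡ c ⊗L d
  ⊗-cong eq = cong (λ s → max 0# (s - 1#)) eq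

  ⊗-⨆ : ∀ a {I : Set} (f : I → R) (i₀ : I) {b} (bounded : ∀ i → f i ≤ b) {c} →
        0# ≤ c → (∀ i → a ⊗L f i ≤ c) → a ⊗L ⨆ f i₀ bounded ≤ c
  ⊗-⨆ a f i₀ bounded 0≤c h = ⊗-le 0≤c (move-left (⨆-least f i₀ bounded λ i →
    move-right (≤-trans (⊗-ge a (f i)) (+-mono-≤ 1# (h i)))))

  module _ {n : ℕ} (A : Matrix n) (l : R) where

    eigen-intro : ∀ x → (∀ i → InUnit (x i)) → (∀ i k → A i k ⊗L x k ≤ l ⊗L x i) →
                  (∀ i → l ⊗L x i ≤ mulL A x i) → IsEigenvector A l x
    eigen-intro x unit sub super =
      unit , λ i → ≤-antisym (max0-least n _ (⊗-nonneg l (x i)) (sub i)) (super i)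

    eigen-sub : ∀ {x} → IsEigenvector A l x → ∀ i k → A i k ⊗L x k ≤ l ⊗L x i
    eigen-sub {x} (_ , eq) i k = subst (A i k ⊗L x k ≤_) (eq i) (max0-ub n _ k)

    eigen-super : ∀ {x} → IsEigenvector A l x → ∀ i → l ⊗L x i ≤ mulL A x i
    eigen-super (_ , eq) i = ≤-reflexive (sym (eq i))

    eigen-edge : ∀ {x} → IsEigenvector A l x → ∀ j k → A j k + x k ≤ (l ⊗L x j) + 1#
    eigen-edge e j k = ≤-trans (⊗-ge _ _) (+-mono-≤ 1# (eigen-sub e j k))

    μ : R
    μ = 1# - l

    l+μ≡1 : l + μ ≡ 1#
    l+μ≡1 = trans (+-swap l 1# (- l)) (trans (cong (1# +_) (-‿inverseʳ l)) (+-identityʳ 1#))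

    walk-step : ∀ i k js → A i k + (μ + walkWeight A l k js) ≡ 1# + walkWeight A l i (k ∷ js)
    walk-step i k js = exchange (A i k) 1# l (walkWeight A l k js)

    walk-step′ : ∀ i k js → l + (μ + walkWeight A l i (k ∷ js)) ≡ A i k + (μ + walkWeight A l k js)
    walk-step′ i k js = begin
      l + (μ + W)   ≡⟨ sym (+-assoc l μ W) ⟩
      (l + μ) + W   ≡⟨ cong (_+ W) l+μ≡1 ⟩
      1# + W        ≡⟨ sym (walk-step i k js) ⟩
      A i k + (μ + walkWeight A l k js) ∎
      where
      open ≡-Reasoning
      W : R
      W = walkWeight A l i (k ∷ js)

  module GreatestEigenvector {n : ℕ} (A : Matrix n) (l : R)
      (A-unit : ∀ i j → InUnit (A i j)) (0≤l : 0# ≤ l) (l≤1 : l ≤ 1#) where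

    0≤1 : 0# ≤ 1#
    0≤1 = ≤-trans 0≤l l≤1

    -- The zero vector is an eigenvector, so the supremum below is over a nonempty family.
    zero-eigen : IsEigenvector A l (λ _ → 0#)
    zero-eigen = eigen-intro A l _ (λ _ → ≤-refl 0# , 0≤1)
      (λ i k → ⊗-vanish (≤-trans (≤-reflexive (+-identityʳ _)) (proj₂ (A-unit i k))) (⊗-nonneg l 0#))
      (λ i → ⊗-vanish (≤-trans (≤-reflexive (+-identityʳ l)) l≤1) (max0-nonneg n _))

    Eigenvector : Set
    Eigenvector = Σ (Vector n) (IsEigenvector A l)

    z : Vector n
    z i = ⨆ (λ (e : Eigenvector) → proj₁ e i) (_ , zero-eigen) (λ e → proj₂ (proj₁ (proj₂ e) i))

    z-above : ∀ x → IsEigenvector A l x → ∀ i → x i ≤ z i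
    z-above x e i = ⨆-ub _ _ _ (x , e)

    z-eigen : IsEigenvector A l z
    z-eigen = eigen-intro A l z
      (λ i → z-above _ zero-eigen i , ⨆-least _ _ _ (λ e → proj₂ (proj₁ (proj₂ e) i)))
      (λ i k → ⊗-⨆ (A i k) _ _ _ (⊗-nonneg l (z i)) λ (x , e) →
         ≤-trans (eigen-sub A l e i k) (⊗-mono l (z-above x e i)))
      (λ i → ⊗-⨆ l _ _ _ (max0-nonneg n _) λ (x , e) →
         ≤-trans (eigen-super A l e i) (max0-mono n (λ k → ⊗-mono (A i k) (z-above x e k))))

    z-greatest : IsGreatestEigenvector A l z
    z-greatest = z-eigen , z-above

    module Security (K : Subset n) (K-def : ∀ i → (i ∈ K) ⇔ (μ A l ≤ z i)) where

      -- Membership in K means λ ⊗ z_j is exact; outside K it vanishes.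
      large : ∀ {j} → j ∈ K → 1# ≤ l + z j
      large {j} j∈K = subst (_≤ l + z j) (l+μ≡1 A l) (+-monoʳ-≤ l (Equivalence.to (K-def j) j∈K))

      small : ∀ {i} → i ∉ K → l + z i ≤ 1#
      small {i} i∉K with ≤-total (μ A l) (z i)
      ... | inj₁ μ≤z = ⊥-elim (i∉K (Equivalence.from (K-def i) μ≤z))
      ... | inj₂ z≤μ = subst (l + z i ≤_) (l+μ≡1 A l) (+-monoʳ-≤ l z≤μ)

      walk-inside : ∀ j js → j ∈ K → All (_∈ K) js → μ A l + walkWeight A l j js ≤ z j
      walk-inside j [] j∈K [] =
        ≤-trans (≤-reflexive (+-identityʳ _)) (Equivalence.to (K-def j) j∈K)
      walk-inside j (k ∷ js) j∈K (k∈K ∷ ks∈K) = +-cancelˡ-≤ l (begin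
        l + (μ A l + walkWeight A l j (k ∷ js)) ≡⟨ walk-step′ A l j k js ⟩
        A j k + (μ A l + walkWeight A l k js)   ≤⟨ +-monoʳ-≤ (A j k) (walk-inside k js k∈K ks∈K) ⟩
        A j k + z k                             ≤⟨ eigen-edge A l z-eigen j k ⟩
        (l ⊗L z j) + 1#                         ≤⟨ ⊗-exact (large j∈K) ⟩
        l + z j                                 ∎)
        where open ≤-Reasoning

      walk-leaving : ∀ i js → i ∉ K → All (_∈ K) js → walkWeight A l i js ≤ 0#
      walk-leaving i [] i∉K [] = ≤-refl 0#
      walk-leaving i (k ∷ js) i∉K (k∈K ∷ ks∈K) = +-cancelˡ-≤ 1# (begin
        1# + walkWeight A l i (k ∷ js)        ≡⟨ sym (walk-step A l i k js) ⟩
        A i k + (μ A l + walkWeight A l k js) ≤⟨ +-monoʳ-≤ (A i k) (walk-inside k js k∈K ks∈K) ⟩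
        A i k + z k                           ≤⟨ eigen-edge A l z-eigen i k ⟩
        (l ⊗L z i) + 1#                       ≤⟨ +-mono-≤ 1# (⊗-vanish (small i∉K) (≤-refl 0#)) ⟩
        0# + 1#                               ≡⟨ +-comm 0# 1# ⟩
        1# + 0#                               ∎)
        where open ≤-Reasoning

      walk-everywhere : (∀ i → i ∈ K) → ∀ i js → walkWeight A l i js ≤ l
      walk-everywhere all∈K i js = +-cancelˡ-≤ (μ A l) (begin
        μ A l + walkWeight A l i js ≤⟨ walk-inside i js (all∈K i) (inside js) ⟩
        z i                         ≤⟨ proj₂ (proj₁ z-eigen i) ⟩
        1#                          ≡⟨ sym (trans (+-comm (μ A l) l) (l+μ≡1 A l)) ⟩
        μ A l + l                   ∎)
        where
        open ≤-Reasoning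
        inside : ∀ js → All (_∈ K) js
        inside [] = []
        inside (j ∷ js) = all∈K j ∷ inside js

      secure : Secure A l K
      secure = (λ _ _ → walk-leaving) , walk-everywhere

    module Minimality (K′ : Subset n) (K′-secure : Secure A l K′) where

      walk-bound : ∀ j js → j ∈ K′ → All (_∈ K′) js → μ A l + walkWeight A l j js ≤ 1#
      walk-bound j js j∈K′ js∈K′ with nonempty? (∁ K′)
      ... | yes (p , p∈L′) = begin
        μ A l + walkWeight A l j js           ≤⟨ ≤-+ˡ _ (proj₁ (A-unit p j)) ⟩
        A p j + (μ A l + walkWeight A l j js) ≡⟨ walk-step A l p j js ⟩
        1# + walkWeight A l p (j ∷ js)        ≤⟨ +-monoʳ-≤ 1# (proj₁ K′-secure (j , j∈K′) (p , p∈L′)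
                                                   p (j ∷ js) (x∈∁p⇒x∉p p∈L′) (j∈K′ ∷ js∈K′)) ⟩
        1# + 0#                               ≡⟨ +-identityʳ 1# ⟩
        1#                                    ∎
        where open ≤-Reasoning
      ... | no L′-empty = begin
        μ A l + walkWeight A l j js ≤⟨ +-monoʳ-≤ (μ A l) (proj₂ K′-secure all∈K′ j js) ⟩
        μ A l + l                   ≡⟨ trans (+-comm (μ A l) l) (l+μ≡1 A l) ⟩
        1#                          ∎
        where
        open ≤-Reasoning
        all∈K′ : ∀ k → k ∈ K′
        all∈K′ k = x∉∁p⇒x∈p (λ k∈L′ → L′-empty (k , k∈L′))

      -- The options defining x_j: stay (value 0), or follow a walk inside K′.
      Route : Fin n → Set
      Route j = ⊤ ⊎ (j ∈ K′ × Σ (List (Fin n)) (All (_∈ K′)))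

      value : ∀ j → Route j → R
      value j (inj₁ _) = 0#
      value j (inj₂ (_ , js , _)) = μ A l + walkWeight A l j js

      value≤1 : ∀ j r → value j r ≤ 1#
      value≤1 j (inj₁ _) = 0≤1
      value≤1 j (inj₂ (j∈K′ , js , js∈K′)) = walk-bound j js j∈K′ js∈K′

      x : Vector n
      x j = ⨆ (value j) (inj₁ tt) (value≤1 j)

      x-walk : ∀ {j} js → j ∈ K′ → All (_∈ K′) js → μ A l + walkWeight A l j js ≤ x j
      x-walk js j∈K′ js∈K′ = ⨆-ub _ _ _ (inj₂ (j∈K′ , js , js∈K′))

      x-outside : ∀ {j} → j ∉ K′ → x j ≤ 0#
      x-outside j∉K′ = ⨆-least _ _ _ λ
        { (inj₁ _) → ≤-refl 0#
        ; (inj₂ (j∈K′ , _)) → ⊥-elim (j∉K′ j∈K′) }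

      x-unit : ∀ j → InUnit (x j)
      x-unit j = ⨆-ub _ _ _ (inj₁ tt) , ⨆-least _ _ _ (value≤1 j)

      x-sub : ∀ i k → A i k ⊗L x k ≤ l ⊗L x i
      x-sub i k = ⊗-⨆ (A i k) _ _ _ (⊗-nonneg l (x i)) term
        where
        term : ∀ r → A i k ⊗L value k r ≤ l ⊗L x i
        term (inj₁ _) = ⊗-vanish (≤-trans (≤-reflexive (+-identityʳ _)) (proj₂ (A-unit i k))) (⊗-nonneg l (x i))
        term (inj₂ (k∈K′ , js , js∈K′)) with i ∈? K′
        ... | yes i∈K′ = begin
          A i k ⊗L (μ A l + walkWeight A l k js)   ≡⟨ ⊗-cong (sym (walk-step′ A l i k js)) ⟩
          l ⊗L (μ A l + walkWeight A l i (k ∷ js)) ≤⟨ ⊗-mono l (x-walk (k ∷ js) i∈K′ (k∈K′ ∷ js∈K′)) ⟩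
          l ⊗L x i                                 ∎
          where open ≤-Reasoning
        ... | no i∉K′ = ⊗-vanish (begin
          A i k + (μ A l + walkWeight A l k js) ≡⟨ walk-step A l i k js ⟩
          1# + walkWeight A l i (k ∷ js)        ≤⟨ +-monoʳ-≤ 1# (proj₁ K′-secure (k , k∈K′) (i , x∉p⇒x∈∁p i∉K′)
                                                     i (k ∷ js) i∉K′ (k∈K′ ∷ js∈K′)) ⟩
          1# + 0#                               ≡⟨ +-identityʳ 1# ⟩
          1#                                    ∎) (⊗-nonneg l (x i))
          where open ≤-Reasoning

      x-super : ∀ i → l ⊗L x i ≤ mulL A x i
      x-super i with i ∈? K′
      ... | no i∉K′ = ⊗-vanish (subst (l + x i ≤_) (+-identityʳ 1#) (+-mono-≤₂ l≤1 (x-outside i∉K′)))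
                               (max0-nonneg n _)
      ... | yes _ = ⊗-⨆ l _ _ _ (max0-nonneg n _) term
        where
        term : ∀ r → l ⊗L value i r ≤ mulL A x i
        term (inj₁ _) = ⊗-vanish (≤-trans (≤-reflexive (+-identityʳ l)) l≤1) (max0-nonneg n _)
        term (inj₂ (_ , [] , [])) =
          ⊗-vanish (≤-reflexive (trans (cong (l +_) (+-identityʳ _)) (l+μ≡1 A l))) (max0-nonneg n _)
        term (inj₂ (_ , k ∷ js , k∈K′ ∷ js∈K′)) = begin
          l ⊗L (μ A l + walkWeight A l i (k ∷ js)) ≡⟨ ⊗-cong (walk-step′ A l i k js) ⟩
          A i k ⊗L (μ A l + walkWeight A l k js)   ≤⟨ ⊗-mono (A i k) (x-walk js k∈K′ js∈K′) ⟩
          A i k ⊗L x k                             ≤⟨ max0-ub n _ k ⟩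
          mulL A x i                               ∎
          where open ≤-Reasoning

      x-eigen : IsEigenvector A l x
      x-eigen = eigen-intro A l x x-unit x-sub x-super

      above-μ : ∀ {i} → i ∈ K′ → μ A l ≤ z i
      above-μ {i} i∈K′ = ≤-trans (≤-trans (≤-reflexive (sym (+-identityʳ _))) (x-walk [] i∈K′ []))
                                 (z-above x x-eigen i)

proposition19 : (F : CompleteOrderedField) →
    let open CompleteOrderedField F
        open Luk F in
    ∀ (n : ℕ) (A : Matrix n) (l : R) →
    (∀ i j → InUnit (A i j)) → 0# < l → l < 1# →
    Σ (Vector n) λ z → IsGreatestEigenvector A l z ×
      (∀ (K : Subset n) → (∀ i → (i ∈ K) ⇔ ((1# - l) ≤ z i)) →
         Secure A l K × (∀ (K′ : Subset n) → Secure A l K′ → ∀ i → i ∉ K → i ∉ K′))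
proposition19 F n A l A-unit (0≤l , _) (l≤1 , _) =
  z , z-greatest , λ K K-def →
    Security.secure K K-def ,
    λ K′ K′-secure i i∉K i∈K′ →
      i∉K (Equivalence.from (K-def i) (Minimality.above-μ K′ K′-secure i∈K′))
  where open LukasiewiczEigen.GreatestEigenvector F A l A-unit 0≤l l≤1
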